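{- Let $\tau^0$ be a non-empty generalized pattern with no hyphens, let $\phi$ be an arbitrary partially ordered generalized pattern, and let $\tau=\tau^0\mbox{ - }\phi$, where the letters of $\tau^0$ are incomparable to the letters of $\phi$. Then for all $k\ge1$, $$A_\tau(x;k)=A_{\tau^0}(x;k)+A_\phi(x;k)\,A^*_{\tau^0}(x;k).$$
   Context: $[k]^n$ = words of length $n$ over $\{1,\dots,k\}$. A generalized pattern with no hyphens is a word over $[m]$ using every letter of $[m]$. A partially ordered generalized pattern (POGP) has letters from a partially ordered set, possibly with hyphens between consecutive letters; a word $\sigma$ contains a POGP $\pi=\pi_1\cdots\pi_r$ if there are indices $i_1<\dots<i_r$ with $i_{j+1}=i_j+1$ whenever $\pi_j,\pi_{j+1}$ are not separated by a hyphen, and for every pair of positions whose letters are comparable (identical letters are equal) the corresponding letters of $\sigma$ stand in the same relation ($<,=,>$); incomparable pairs are unconstrained. Otherwise $\sigma$ avoids $\pi$. $\tau^0\mbox{ - }\phi$ denotes the concatenation of $\tau^0$ and $\phi$ separated by a hyphen. $A_\pi(x;k)=\sum_{n\ge0}a_\pi(n;k)x^n$, $a_\pi(n;k)$ the number of words in $[k]^n$ avoiding $\pi$. A word quasi-avoids a hyphen-free pattern $\rho$ of length $m$ if it has exactly one occurrence of $\rho$ and that occurrence consists of its $m$ rightmost letters; $A^*_\rho(x;k)=\sum_{n\ge0}a^*_\rho(n;k)x^n$ with $a^*_\rho(n;k)$ the number of words in $[k]^n$ quasi-avoiding $\rho$. -}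

module Defs where

open import Level using (0ℓ)
open import Data.Nat using (ℕ; zero; suc; _*_; _∸_)
open import Data.List using (List; map; upTo; length)
open import Data.Nat.ListAction using (sum)
open import Data.List.Membership.Propositional using (_∈_)
open import Data.List.Relation.Unary.Unique.Propositional using (Unique)
open import Data.Fin as F using (Fin; toℕ)
open import Data.Fin.Properties using (≤-poset)
open import Data.Vec using (Vec; lookup; replicate; _++_; _∷ʳ_)
import Data.Vec as V
open import Data.Bool using (Bool; true; false)
open import Data.Sum using (inj₁; inj₂)
open import Data.Sum.Relation.Binary.Pointwise using (⊎-poset)
open import Data.Product using (Σ; _×_)
open import Relation.Binary.Bundles using (Poset)
open import Relation.Binary.PropositionalEquality using (_≡_)
open import Relation.Nullary using (¬_)
open import Function.Bundles using (_⇔_)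

-- Words of length n over [k] = {1..k}, encoded as Fin k with its usual order.
Word : ℕ → ℕ → Set
Word k n = Vec (Fin k) n

-- A partially ordered generalized pattern (POGP) whose letters come from the
-- poset P.  letters p is the p-th letter; hyph p = true iff there is a hyphen
-- between positions p and p+1 (the entry for the last position is irrelevant).
record POGP (P : Poset 0ℓ 0ℓ 0ℓ) : Set where
  constructor pogp
  field
    len     : ℕ
    letters : Vec (Poset.Carrier P) len
    hyph    : Vec Bool len

open POGP public

record Occurrence {P : Poset 0ℓ 0ℓ 0ℓ} {k n : ℕ} (π : POGP P) (σ : Word k n) : Set where
  open Poset P using (_≈_; _≤_)
  field
    idx  : Fin (len π) → Fin n
    mono : ∀ p q → p F.< q → idx p F.< idx q
    adj  : ∀ p q → toℕ q ≡ suc (toℕ p) → lookup (hyph π) p ≡ false →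
           toℕ (idx q) ≡ suc (toℕ (idx p))
    eqs  : ∀ p q → lookup (letters π) p ≈ lookup (letters π) q →
           lookup σ (idx p) ≡ lookup σ (idx q)
    -- strictly smaller letters give strictly smaller letters of σ
    -- (the case > is the symmetric instance); incomparable pairs are free
    lts  : ∀ p q → lookup (letters π) p ≤ lookup (letters π) q →
           ¬ (lookup (letters π) p ≈ lookup (letters π) q) →
           lookup σ (idx p) F.< lookup σ (idx q)

Contains : {P : Poset 0ℓ 0ℓ 0ℓ} {k n : ℕ} → POGP P → Word k n → Set
Contains π σ = Occurrence π σ

Avoids : {P : Poset 0ℓ 0ℓ 0ℓ} {k n : ℕ} → POGP P → Word k n → Set
Avoids π σ = ¬ Contains π σ

-- A generalized pattern with no hyphens: a non-empty word over [m]
-- (here of length suc r) using every letter of [m].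
UsesAll : {m r : ℕ} → Vec (Fin m) r → Set
UsesAll {m} ρ = ∀ (a : Fin m) → a V.∈ ρ
  where import Data.Vec.Membership.Propositional as V

genPat : {m r : ℕ} → Vec (Fin m) r → POGP (≤-poset m)
genPat {m} {r} ρ = pogp r ρ (replicate r false)

QuasiAvoids : {m r k n : ℕ} → Vec (Fin m) (suc r) → Word k n → Set
QuasiAvoids {r = r} {n = n} ρ σ =
  Σ (Occurrence (genPat ρ) σ) λ o →
    (suc (toℕ (Occurrence.idx o (F.fromℕ r))) ≡ n)
    × ((o′ : Occurrence (genPat ρ) σ) → ∀ p → Occurrence.idx o′ p ≡ Occurrence.idx o p)

-- The pattern τ = τ⁰-φ over the disjoint union of [m] and P, where letters of
-- τ⁰ are incomparable to letters of φ.
concatPat : {m r : ℕ} {P : Poset 0ℓ 0ℓ 0ℓ} →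
            Vec (Fin m) (suc r) → POGP P → POGP (⊎-poset (≤-poset m) P)
concatPat {r = r} τ⁰ φ =
  pogp (suc r Data.Nat.+ len φ)
       (V.map inj₁ τ⁰ ++ V.map inj₂ (letters φ))
       ((replicate r false ∷ʳ true) ++ hyph φ)

-- c is the number of words in [k]^n satisfying the predicate Q.
-- (Stated via an explicit duplicate-free enumeration, since Q need not be decidable.)
IsCount : {k n : ℕ} → (Word k n → Set) → ℕ → Set
IsCount {k} {n} Q c =
  Σ (List (Word k n)) λ ws → Unique ws × (∀ w → (w ∈ ws) ⇔ Q w) × length ws ≡ c

-- Coefficient of x^n in the product of the series with coefficients c and d.
conv : (ℕ → ℕ) → (ℕ → ℕ) → ℕ → ℕ
conv c d n = sum (map (λ i → c i * d (n ∸ i)) (upTo (suc n)))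

{-# OPTIONS --safe #-}
-- A word σ avoids τ⁰-φ iff either it avoids τ⁰, or it contains τ⁰ and,
-- cutting σ = αβ right after the occurrence of τ⁰ that ends first, β avoids φ.
-- As τ⁰ has no hyphens its occurrences are factors, so the prefixes α that
-- arise are exactly the words quasi-avoiding τ⁰, and the pairs (α, β) with
-- |β| = i are counted by a*_{τ⁰}(n - i) · a_φ(i).  The first occurrence is only
-- found up to double negation; this suffices because membership in a finite
-- enumeration of words is decidable.
module Submission where

open import Defs
open import Level using (0ℓ)
open import Data.Nat using (ℕ; zero; suc; _+_; _*_; _∸_; _≤_; _<_; s≤s; s≤s⁻¹)
open import Data.Nat.Properties
  using (+-identityʳ; +-suc; *-comm; suc-injective; +-cancelˡ-≡; +-cancelʳ-≡; +-cancelˡ-<; +-monoʳ-≤; +-monoʳ-<;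
         ≤-refl; ≤-reflexive; ≤-trans; ≤-antisym; <⇒≤; <-irrefl; <-asym; <-≤-trans; ≮⇒≥; m≤m+n;
         m<n⇒m<1+n; m<1+n⇒m<n∨m≡n; m∸n≤m; m∸n+n≡m; m∸[m∸n]≡n; ∸-cancelˡ-≡)
open import Data.Nat.Induction using (<-wellFounded)
open import Data.Nat.ListAction using (sum)
open import Data.Nat.ListAction.Properties using (sum-++)
open import Data.Fin as F using (Fin; toℕ; fromℕ; fromℕ<; inject₁; reduce≥; _↑ˡ_; _↑ʳ_)
open import Data.Fin.Properties
  using (≤-poset; toℕ-injective; toℕ<n; toℕ≤pred[n]; toℕ-fromℕ; toℕ-fromℕ<; toℕ-inject₁;
         toℕ-↑ˡ; toℕ-↑ʳ; splitAt-<; splitAt-≥; splitAt⁻¹-↑ˡ; splitAt⁻¹-↑ʳ)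
open import Data.Fin.Induction using (<-weakInduction)
open import Data.Vec as V using (Vec; lookup; replicate; _++_; _∷ʳ_; splitAt)
open import Data.Vec.Properties using (lookup-++ˡ; lookup-++ʳ; lookup-replicate; lookup-map; ++-injective; ≡-dec)
open import Data.List as List using (List; []; _∷_; length; map; upTo; cartesianProductWith)
open import Data.List.Properties using (length-++; length-map; upTo-∷ʳ; map-++)
open import Data.List.Membership.Propositional using (_∈_)
open import Data.List.Membership.Propositional.Properties
  using (++-∈⇔; ∈-cartesianProductWith⁺; ∈-cartesianProductWith⁻)
open import Data.List.Membership.Propositional.Properties.WithK using (unique∧set⇒bag)
open import Data.List.Relation.Unary.AllPairs using ([])
open import Data.List.Relation.Unary.Unique.Propositional.Properties using (++⁺; cartesianProductWith⁺)
open import Data.List.Relation.Binary.BagAndSetEquality using (∼bag⇒↭)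
open import Data.List.Relation.Binary.Permutation.Propositional.Properties using (↭-length)
open import Data.Bool using (true; false)
open import Data.Sum using (_⊎_; inj₁; inj₂; [_,_]′)
import Data.Sum as Sum
open import Data.Sum.Function.Propositional using (_⊎-⇔_)
open import Data.Sum.Relation.Binary.Pointwise as Pointwise using (⊎-poset)
open import Data.Product using (Σ-syntax; ∃; ∃-syntax; ∃₂; _×_; _,_; proj₁; proj₂)
open import Function using (_∘_)
open import Function.Bundles using (_⇔_; mk⇔; Equivalence)
open import Function.Properties.Equivalence using () renaming (refl to ⇔-refl; trans to ⇔-trans)
open import Induction.WellFounded using (Acc; acc)
open import Relation.Binary.Bundles using (Poset)
open import Relation.Binary.PropositionalEquality
open import Relation.Nullary using (¬_; contradiction)
open import Relation.Nullary.Decidable using (decidable-stable)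

open Occurrence
open Equivalence using (to; from)

length-cartesianProductWith : {A B C : Set} (f : A → B → C) (xs : List A) (ys : List B) →
                              length (cartesianProductWith f xs ys) ≡ length xs * length ys
length-cartesianProductWith f []       ys = refl
length-cartesianProductWith f (x ∷ xs) ys = begin
  length (map (f x) ys List.++ cartesianProductWith f xs ys)   ≡⟨ length-++ (map (f x) ys) ⟩
  length (map (f x) ys) + length (cartesianProductWith f xs ys) ≡⟨ cong₂ _+_ (length-map (f x) ys)
                                                                     (length-cartesianProductWith f xs ys) ⟩
  length ys + length xs * length ys                             ∎
  where open ≡-Reasoning

sum-upTo-suc : (c : ℕ → ℕ) (j : ℕ) → sum (map c (upTo (suc j))) ≡ sum (map c (upTo j)) + c j
sum-upTo-suc c j = begin
  sum (map c (upTo (suc j)))              ≡⟨ cong (sum ∘ map c) (upTo-∷ʳ j) ⟨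
  sum (map c (upTo j List.∷ʳ j))          ≡⟨ cong sum (map-++ c (upTo j) (j ∷ [])) ⟩
  sum (map c (upTo j) List.++ (c j ∷ [])) ≡⟨ sum-++ (map c (upTo j)) (c j ∷ []) ⟩
  sum (map c (upTo j)) + (c j + 0)        ≡⟨ cong (sum (map c (upTo j)) +_) (+-identityʳ (c j)) ⟩
  sum (map c (upTo j)) + c j              ∎
  where open ≡-Reasoning

module _ {k n : ℕ} where

  IsCount-resp : {P Q : Word k n → Set} {c : ℕ} → (∀ w → P w ⇔ Q w) → IsCount P c → IsCount Q c
  IsCount-resp P⇔Q (ws , unique , ∈ws⇔P , count) = ws , unique , (λ w → ⇔-trans (∈ws⇔P w) (P⇔Q w)) , count

  IsCount-unique : {P Q : Word k n → Set} {c d : ℕ} → IsCount P c → IsCount Q d →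
                   (∀ w → P w → ¬ ¬ Q w) → (∀ w → Q w → P w) → c ≡ d
  IsCount-unique (xs , unique-xs , ∈xs⇔P , refl) (ys , unique-ys , ∈ys⇔Q , refl) P⇒¬¬Q Q⇒P =
    ↭-length (∼bag⇒↭ (unique∧set⇒bag unique-xs unique-ys (mk⇔ (xs⊆ys _) (ys⊆xs _))))
    where
    open import Data.List.Membership.DecPropositional (≡-dec {n = n} F._≟_) using (_∈?_)
    xs⊆ys : ∀ w → w ∈ xs → w ∈ ys
    xs⊆ys w w∈xs = decidable-stable (w ∈? ys)
      λ w∉ys → P⇒¬¬Q w (to (∈xs⇔P w) w∈xs) (w∉ys ∘ from (∈ys⇔Q w))
    ys⊆xs : ∀ w → w ∈ ys → w ∈ xs
    ys⊆xs w = from (∈xs⇔P w) ∘ Q⇒P w ∘ to (∈ys⇔Q w)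

  IsCount-⊎ : {P Q : Word k n → Set} {c d : ℕ} → IsCount P c → IsCount Q d →
              (∀ {w} → P w → ¬ Q w) → IsCount (λ w → P w ⊎ Q w) (c + d)
  IsCount-⊎ (xs , unique-xs , ∈xs⇔P , refl) (ys , unique-ys , ∈ys⇔Q , refl) disjoint =
    xs List.++ ys ,
    ++⁺ unique-xs unique-ys (λ (w∈xs , w∈ys) → disjoint (to (∈xs⇔P _) w∈xs) (to (∈ys⇔Q _) w∈ys)) ,
    (λ w → ⇔-trans ++-∈⇔ (∈xs⇔P w ⊎-⇔ ∈ys⇔Q w)) ,
    length-++ xs

  IsCount-⋃ : {P : ℕ → Word k n → Set} {c : ℕ → ℕ} (j : ℕ) →
              (∀ i → i < j → IsCount (P i) (c i)) →
              (∀ {i i′ w} → i < j → i′ < j → P i w → P i′ w → i ≡ i′) →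
              IsCount (λ w → ∃[ i ] i < j × P i w) (sum (map c (upTo j)))
  IsCount-⋃ zero _ _ = [] , [] , (λ w → mk⇔ (λ ()) λ ()) , refl
  IsCount-⋃ {P} {c} (suc j) count disjoint =
    IsCount-resp separate-last (subst (IsCount _) (sym (sum-upTo-suc c j))
      (IsCount-⊎ (IsCount-⋃ j (λ i i<j → count i (m<n⇒m<1+n i<j))
                              (λ i<j i′<j → disjoint (m<n⇒m<1+n i<j) (m<n⇒m<1+n i′<j)))
                 (count j ≤-refl)
                 (λ (i , i<j , Piw) Pjw → <-irrefl (disjoint (m<n⇒m<1+n i<j) ≤-refl Piw Pjw) i<j)))
    where
    separate-last : ∀ w → ((∃[ i ] i < j × P i w) ⊎ P j w) ⇔ (∃[ i ] i < suc j × P i w)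
    separate-last w = mk⇔ [ (λ (i , i<j , Piw) → i , m<n⇒m<1+n i<j , Piw) , (λ Pjw → j , ≤-refl , Pjw) ]′
                          λ (i , i<1+j , Piw) → Sum.map (λ i<j → i , i<j , Piw) (λ { refl → Piw })
                                                        (m<1+n⇒m<n∨m≡n i<1+j)

module _ {k a b : ℕ} where

  IsCount-++ : {P : Word k a → Set} {Q : Word k b → Set} {c d : ℕ} → IsCount P c → IsCount Q d →
               IsCount (λ w → ∃₂ λ α β → P α × Q β × w ≡ α ++ β) (c * d)
  IsCount-++ {P} {Q} (xs , unique-xs , ∈xs⇔P , refl) (ys , unique-ys , ∈ys⇔Q , refl) =
    cartesianProductWith _++_ xs ys ,
    cartesianProductWith⁺ _++_ (λ {α} {α′} → ++-injective α α′) unique-xs unique-ys ,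
    (λ w → mk⇔ (decompose w) λ (α , β , Pα , Qβ , w≡αβ) →
                 subst (_∈ _) (sym w≡αβ) (∈-cartesianProductWith⁺ _++_ (from (∈xs⇔P α) Pα) (from (∈ys⇔Q β) Qβ))) ,
    length-cartesianProductWith _++_ xs ys
    where
    decompose : ∀ w → w ∈ cartesianProductWith _++_ xs ys → ∃₂ λ α β → P α × Q β × w ≡ α ++ β
    decompose w w∈ with ∈-cartesianProductWith⁻ _++_ xs ys w∈
    ... | α , β , α∈xs , β∈ys , w≡αβ = α , β , to (∈xs⇔P α) α∈xs , to (∈ys⇔Q β) β∈ys , w≡αβ

record Factor {k a n : ℕ} (α : Word k a) (σ : Word k n) : Set where
  field
    offset       : ℕ
    embed        : Fin a → Fin n
    toℕ-embed    : ∀ i → toℕ (embed i) ≡ offset + toℕ i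
    lookup-embed : ∀ i → lookup σ (embed i) ≡ lookup α i

open Factor

module _ {P : Poset 0ℓ 0ℓ 0ℓ} {π : POGP P} {k a n : ℕ} {α : Word k a} {σ : Word k n} (f : Factor α σ) where

  push : Occurrence π α → Occurrence π σ
  push o .idx p = embed f (idx o p)
  push o .mono p q p<q =
    subst₂ _<_ (sym (toℕ-embed f _)) (sym (toℕ-embed f _)) (+-monoʳ-< (offset f) (mono o p q p<q))
  push o .adj p q q≡1+p unhyphenated = begin
    toℕ (embed f (idx o q))           ≡⟨ toℕ-embed f _ ⟩
    offset f + toℕ (idx o q)          ≡⟨ cong (offset f +_) (adj o p q q≡1+p unhyphenated) ⟩
    offset f + suc (toℕ (idx o p))    ≡⟨ +-suc (offset f) _ ⟩
    suc (offset f + toℕ (idx o p))    ≡⟨ cong suc (toℕ-embed f _) ⟨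
    suc (toℕ (embed f (idx o p)))     ∎
    where open ≡-Reasoning
  push o .eqs p q p≈q = trans (lookup-embed f _) (trans (eqs o p q p≈q) (sym (lookup-embed f _)))
  push o .lts p q p≤q p≉q =
    subst₂ F._<_ (sym (lookup-embed f _)) (sym (lookup-embed f _)) (lts o p q p≤q p≉q)

  module _ (o : Occurrence π σ) (g : Fin (len π) → Fin a) (embed∘g : ∀ p → embed f (g p) ≡ idx o p) where

    private
      toℕ-idx : ∀ p → toℕ (idx o p) ≡ offset f + toℕ (g p)
      toℕ-idx p = trans (cong toℕ (sym (embed∘g p))) (toℕ-embed f (g p))

      lookup-idx : ∀ p → lookup σ (idx o p) ≡ lookup α (g p)
      lookup-idx p = trans (cong (lookup σ) (sym (embed∘g p))) (lookup-embed f (g p))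

    pull : Occurrence π α
    pull .idx = g
    pull .mono p q p<q = +-cancelˡ-< (offset f) _ _ (subst₂ _<_ (toℕ-idx p) (toℕ-idx q) (mono o p q p<q))
    pull .adj p q q≡1+p unhyphenated = +-cancelˡ-≡ (offset f) _ _ (begin
      offset f + toℕ (g q)          ≡⟨ toℕ-idx q ⟨
      toℕ (idx o q)                 ≡⟨ adj o p q q≡1+p unhyphenated ⟩
      suc (toℕ (idx o p))           ≡⟨ cong suc (toℕ-idx p) ⟩
      suc (offset f + toℕ (g p))    ≡⟨ +-suc (offset f) _ ⟨
      offset f + suc (toℕ (g p))    ∎)
      where open ≡-Reasoning
    pull .eqs p q p≈q = trans (sym (lookup-idx p)) (trans (eqs o p q p≈q) (lookup-idx q))
    pull .lts p q p≤q p≉q = subst₂ F._<_ (lookup-idx p) (lookup-idx q) (lts o p q p≤q p≉q)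

module _ {k a b : ℕ} (α : Word k a) (β : Word k b) where

  prefix : Factor α (α ++ β)
  prefix = record { offset = 0 ; embed = _↑ˡ b ; toℕ-embed = λ i → toℕ-↑ˡ i b ; lookup-embed = lookup-++ˡ α β }

  suffix : Factor β (α ++ β)
  suffix = record { offset = a ; embed = a ↑ʳ_ ; toℕ-embed = toℕ-↑ʳ a ; lookup-embed = lookup-++ʳ α β }

module _ {P : Poset 0ℓ 0ℓ 0ℓ} {π : POGP P} {k a b : ℕ} (α : Word k a) (β : Word k b) where

  restrictˡ : (o : Occurrence π (α ++ β)) → (∀ p → toℕ (idx o p) < a) → Occurrence π α
  restrictˡ o below = pull (prefix α β) o (λ p → fromℕ< (below p))
                        (λ p → splitAt⁻¹-↑ˡ (splitAt-< a (idx o p) (below p)))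

  restrictʳ : (o : Occurrence π (α ++ β)) → (∀ p → a ≤ toℕ (idx o p)) → Occurrence π β
  restrictʳ o above = pull (suffix α β) o (λ p → reduce≥ (idx o p) (above p))
                        (λ p → splitAt⁻¹-↑ʳ (splitAt-≥ a (idx o p) (above p)))

module _ {m r : ℕ} {ρ : Vec (Fin m) (suc r)} {k n : ℕ} {σ : Word k n} where

  start end : Occurrence (genPat ρ) σ → ℕ
  start o = toℕ (idx o F.zero)
  end o = suc (toℕ (idx o (fromℕ r)))

  contiguous : (o : Occurrence (genPat ρ) σ) (i : Fin (suc r)) → toℕ (idx o i) ≡ start o + toℕ i
  contiguous o = <-weakInduction (λ i → toℕ (idx o i) ≡ start o + toℕ i) (sym (+-identityʳ (start o))) step
    where
    open ≡-Reasoning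
    step : ∀ j → toℕ (idx o (inject₁ j)) ≡ start o + toℕ (inject₁ j) → toℕ (idx o (F.suc j)) ≡ start o + suc (toℕ j)
    step j hyp = begin
      toℕ (idx o (F.suc j))         ≡⟨ adj o (inject₁ j) (F.suc j) (cong suc (sym (toℕ-inject₁ j)))
                                           (lookup-replicate (inject₁ j) false) ⟩
      suc (toℕ (idx o (inject₁ j))) ≡⟨ cong suc (trans hyp (cong (start o +_) (toℕ-inject₁ j))) ⟩
      suc (start o + toℕ j)         ≡⟨ +-suc (start o) (toℕ j) ⟨
      start o + suc (toℕ j)         ∎

  end≡suc[start+r] : (o : Occurrence (genPat ρ) σ) → end o ≡ suc (start o + r)
  end≡suc[start+r] o = cong suc (trans (contiguous o (fromℕ r)) (cong (start o +_) (toℕ-fromℕ r)))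

  idx<end : (o : Occurrence (genPat ρ) σ) (p : Fin (suc r)) → toℕ (idx o p) < end o
  idx<end o p =
    subst₂ _<_ (sym (contiguous o p)) (sym (end≡suc[start+r] o)) (s≤s (+-monoʳ-≤ (start o) (toℕ≤pred[n] p)))

  end-injective : (o o′ : Occurrence (genPat ρ) σ) → end o ≡ end o′ → ∀ p → idx o p ≡ idx o′ p
  end-injective o o′ same-end p = toℕ-injective (begin
    toℕ (idx o p)      ≡⟨ contiguous o p ⟩
    start o + toℕ p    ≡⟨ cong (_+ toℕ p) same-start ⟩
    start o′ + toℕ p   ≡⟨ contiguous o′ p ⟨
    toℕ (idx o′ p)     ∎)
    where
    open ≡-Reasoning
    same-start : start o ≡ start o′
    same-start = +-cancelʳ-≡ r _ _
      (suc-injective (trans (sym (end≡suc[start+r] o)) (trans same-end (end≡suc[start+r] o′))))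

module _ {m r : ℕ} {ρ : Vec (Fin m) (suc r)} {k a n : ℕ} {α : Word k a} {σ : Word k n} where

  end-push : (f : Factor α σ) (o : Occurrence (genPat ρ) α) → end (push f o) ≡ offset f + end o
  end-push f o = trans (cong suc (toℕ-embed f _)) (sym (+-suc (offset f) _))

ShortestPrefixContaining : {m r k n : ℕ} → Vec (Fin m) (suc r) → Word k n → ℕ → Set
ShortestPrefixContaining ρ σ a =
  Σ[ o ∈ Occurrence (genPat ρ) σ ] end o ≡ a × ((o′ : Occurrence (genPat ρ) σ) → a ≤ end o′)

module _ {m r : ℕ} {ρ : Vec (Fin m) (suc r)} {k n : ℕ} {σ : Word k n} where

  shortestPrefix-unique : {a b : ℕ} → ShortestPrefixContaining ρ σ a → ShortestPrefixContaining ρ σ b → a ≡ b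
  shortestPrefix-unique (o , refl , a≤end) (o′ , refl , b≤end) = ≤-antisym (a≤end o′) (b≤end o)

  shortestPrefix-exists : Occurrence (genPat ρ) σ → ¬ ¬ ∃ (ShortestPrefixContaining ρ σ)
  shortestPrefix-exists o = go o (<-wellFounded (end o))
    where
    go : (o : Occurrence (genPat ρ) σ) → Acc _<_ (end o) → ¬ ¬ ∃ (ShortestPrefixContaining ρ σ)
    go o (acc shorter) none = none (end o , o , refl , λ o′ → ≮⇒≥ λ o′<o → go o′ (shorter o′<o) none)

module _ {m r : ℕ} {ρ : Vec (Fin m) (suc r)} {k a b : ℕ} {α : Word k a} {β : Word k b} where

  quasiAvoids⇔shortestPrefix : QuasiAvoids ρ α ⇔ ShortestPrefixContaining ρ (α ++ β) a
  quasiAvoids⇔shortestPrefix = mk⇔ quasiAvoids⇒ shortestPrefix⇒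
    where
    end-restrictˡ : (o : Occurrence (genPat ρ) (α ++ β)) (below : ∀ p → toℕ (idx o p) < a) →
                    end (restrictˡ α β o below) ≡ end o
    end-restrictˡ o below = cong suc (toℕ-fromℕ< (below (fromℕ r)))

    below-of : (o : Occurrence (genPat ρ) (α ++ β)) → end o ≤ a → ∀ p → toℕ (idx o p) < a
    below-of o end≤a p = <-≤-trans (idx<end o p) end≤a

    quasiAvoids⇒ : QuasiAvoids ρ α → ShortestPrefixContaining ρ (α ++ β) a
    quasiAvoids⇒ (o , end≡a , unique) = push (prefix α β) o , trans (end-push (prefix α β) o) end≡a , a≤end
      where
      end≡a-if-≤ : ∀ o′ → end o′ ≤ a → end o′ ≡ a
      end≡a-if-≤ o′ end≤a = begin
        end o′                        ≡⟨ end-restrictˡ o′ below ⟨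
        end (restrictˡ α β o′ below)  ≡⟨ cong (suc ∘ toℕ) (unique (restrictˡ α β o′ below) (fromℕ r)) ⟩
        end o                         ≡⟨ end≡a ⟩
        a                             ∎
        where
        open ≡-Reasoning
        below = below-of o′ end≤a

      a≤end : ∀ o′ → a ≤ end o′
      a≤end o′ = ≮⇒≥ λ end<a → <-irrefl (end≡a-if-≤ o′ (<⇒≤ end<a)) end<a

    shortestPrefix⇒ : ShortestPrefixContaining ρ (α ++ β) a → QuasiAvoids ρ α
    shortestPrefix⇒ (o , end≡a , a≤end) = o₀ , end-o₀ , unique
      where
      below = below-of o (≤-reflexive end≡a)
      o₀ = restrictˡ α β o below
      end-o₀ : end o₀ ≡ a
      end-o₀ = trans (end-restrictˡ o below) end≡a
      unique : ∀ o′ p → idx o′ p ≡ idx o₀ p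
      unique o′ = end-injective o′ o₀ (trans (≤-antisym (toℕ<n (idx o′ (fromℕ r))) a≤end-o′) (sym end-o₀))
        where
        a≤end-o′ : a ≤ end o′
        a≤end-o′ = subst (a ≤_) (end-push (prefix α β) o′) (a≤end (push (prefix α β) o′))

data SplitView (a b : ℕ) : Fin (a + b) → Set where
  left  : (i : Fin a) → SplitView a b (i ↑ˡ b)
  right : (j : Fin b) → SplitView a b (a ↑ʳ j)

splitView : ∀ a b (p : Fin (a + b)) → SplitView a b p
splitView zero    b p         = right p
splitView (suc a) b F.zero    = left F.zero
splitView (suc a) b (F.suc p) with splitView a b p
... | left i  = left (F.suc i)
... | right j = right j

↑ˡ<↑ʳ : ∀ {a b} (i : Fin a) (j : Fin b) → toℕ (i ↑ˡ b) < toℕ (a ↑ʳ j)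
↑ˡ<↑ʳ {a} {b} i j = subst₂ _<_ (sym (toℕ-↑ˡ i b)) (sym (toℕ-↑ʳ a j)) (<-≤-trans (toℕ<n i) (m≤m+n a (toℕ j)))

↑ˡ-adjacent-↑ʳ : ∀ {a b} (i : Fin (suc a)) (j : Fin b) → toℕ (suc a ↑ʳ j) ≡ suc (toℕ (i ↑ˡ b)) → toℕ i ≡ a
↑ˡ-adjacent-↑ʳ {a} {b} i j adjacent = ≤-antisym (s≤s⁻¹ (toℕ<n i)) (subst (a ≤_) a+j≡i (m≤m+n a (toℕ j)))
  where
  a+j≡i : a + toℕ j ≡ toℕ i
  a+j≡i = suc-injective (trans (sym (toℕ-↑ʳ (suc a) j)) (trans adjacent (cong suc (toℕ-↑ˡ i b))))

↑ʳ-adjacent : ∀ a {b} (p q : Fin b) → toℕ q ≡ suc (toℕ p) → toℕ (a ↑ʳ q) ≡ suc (toℕ (a ↑ʳ p))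
↑ʳ-adjacent a p q q≡1+p = begin
  toℕ (a ↑ʳ q)        ≡⟨ toℕ-↑ʳ a q ⟩
  a + toℕ q           ≡⟨ cong (a +_) q≡1+p ⟩
  a + suc (toℕ p)     ≡⟨ +-suc a (toℕ p) ⟩
  suc (a + toℕ p)     ≡⟨ cong suc (toℕ-↑ʳ a p) ⟨
  suc (toℕ (a ↑ʳ p))  ∎
  where open ≡-Reasoning

↑ʳ-adjacent⁻¹ : ∀ a {b} (p q : Fin b) → toℕ (a ↑ʳ q) ≡ suc (toℕ (a ↑ʳ p)) → toℕ q ≡ suc (toℕ p)
↑ʳ-adjacent⁻¹ a p q adjacent = +-cancelˡ-≡ a _ _ (begin
  a + toℕ q           ≡⟨ toℕ-↑ʳ a q ⟨
  toℕ (a ↑ʳ q)        ≡⟨ adjacent ⟩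
  suc (toℕ (a ↑ʳ p))  ≡⟨ cong suc (toℕ-↑ʳ a p) ⟩
  suc (a + toℕ p)     ≡⟨ +-suc a (toℕ p) ⟨
  a + suc (toℕ p)     ∎)
  where open ≡-Reasoning

lookup-replicate-∷ʳ-< : ∀ {A : Set} {x y : A} r (i : Fin (suc r)) → toℕ i < r → lookup (replicate r x ∷ʳ y) i ≡ x
lookup-replicate-∷ʳ-< (suc r) F.zero    _   = refl
lookup-replicate-∷ʳ-< (suc r) (F.suc i) i<r = lookup-replicate-∷ʳ-< r i (s≤s⁻¹ i<r)

lookup-replicate-∷ʳ-≡ : ∀ {A : Set} {x y : A} r (i : Fin (suc r)) → toℕ i ≡ r → lookup (replicate r x ∷ʳ y) i ≡ y
lookup-replicate-∷ʳ-≡ zero    F.zero    _   = refl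
lookup-replicate-∷ʳ-≡ (suc r) (F.suc i) i≡r = lookup-replicate-∷ʳ-≡ r i (suc-injective i≡r)

transport⇔ : {A : Set} (R : A → A → Set) {x x′ y y′ : A} → x ≡ x′ → y ≡ y′ → R x y ⇔ R x′ y′
transport⇔ R refl refl = ⇔-refl

module Concatenation {m r : ℕ} (τ⁰ : Vec (Fin m) (suc r)) {P : Poset 0ℓ 0ℓ 0ℓ} (φ : POGP P) where

  τ : POGP (⊎-poset (≤-poset m) P)
  τ = concatPat τ⁰ φ

  private
    L = len φ
    module T = Poset (⊎-poset (≤-poset m) P)
    module P = Poset P

  letters-↑ˡ : ∀ i → lookup (letters τ) (i ↑ˡ L) ≡ inj₁ (lookup τ⁰ i)
  letters-↑ˡ i = trans (lookup-++ˡ (V.map inj₁ τ⁰) (V.map inj₂ (letters φ)) i) (lookup-map i inj₁ τ⁰)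

  letters-↑ʳ : ∀ j → lookup (letters τ) (suc r ↑ʳ j) ≡ inj₂ (lookup (letters φ) j)
  letters-↑ʳ j = trans (lookup-++ʳ (V.map inj₁ τ⁰) (V.map inj₂ (letters φ)) j) (lookup-map j inj₂ (letters φ))

  hyph-↑ˡ : ∀ i → lookup (hyph τ) (i ↑ˡ L) ≡ lookup (replicate r false ∷ʳ true) i
  hyph-↑ˡ = lookup-++ˡ (replicate r false ∷ʳ true) (hyph φ)

  hyph-↑ʳ : ∀ j → lookup (hyph τ) (suc r ↑ʳ j) ≡ lookup (hyph φ) j
  hyph-↑ʳ = lookup-++ʳ (replicate r false ∷ʳ true) (hyph φ)

  ≈-↑ˡ : ∀ i i′ → (lookup (letters τ) (i ↑ˡ L) T.≈ lookup (letters τ) (i′ ↑ˡ L)) ⇔ (lookup τ⁰ i ≡ lookup τ⁰ i′)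
  ≈-↑ˡ i i′ = ⇔-trans (transport⇔ T._≈_ (letters-↑ˡ i) (letters-↑ˡ i′)) (mk⇔ Pointwise.drop-inj₁ Pointwise.inj₁)

  ≤-↑ˡ : ∀ i i′ → (lookup (letters τ) (i ↑ˡ L) T.≤ lookup (letters τ) (i′ ↑ˡ L)) ⇔ (lookup τ⁰ i F.≤ lookup τ⁰ i′)
  ≤-↑ˡ i i′ = ⇔-trans (transport⇔ T._≤_ (letters-↑ˡ i) (letters-↑ˡ i′)) (mk⇔ Pointwise.drop-inj₁ Pointwise.inj₁)

  ≈-↑ʳ : ∀ j j′ → (lookup (letters τ) (suc r ↑ʳ j) T.≈ lookup (letters τ) (suc r ↑ʳ j′)) ⇔
                  (lookup (letters φ) j P.≈ lookup (letters φ) j′)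
  ≈-↑ʳ j j′ = ⇔-trans (transport⇔ T._≈_ (letters-↑ʳ j) (letters-↑ʳ j′)) (mk⇔ Pointwise.drop-inj₂ Pointwise.inj₂)

  ≤-↑ʳ : ∀ j j′ → (lookup (letters τ) (suc r ↑ʳ j) T.≤ lookup (letters τ) (suc r ↑ʳ j′)) ⇔
                  (lookup (letters φ) j P.≤ lookup (letters φ) j′)
  ≤-↑ʳ j j′ = ⇔-trans (transport⇔ T._≤_ (letters-↑ʳ j) (letters-↑ʳ j′)) (mk⇔ Pointwise.drop-inj₂ Pointwise.inj₂)

  module _ {k n : ℕ} {σ : Word k n} where

    Separated : Occurrence (genPat τ⁰) σ → Occurrence φ σ → Set
    Separated o₀ o₁ = ∀ j → end o₀ ≤ toℕ (idx o₁ j)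

    split : Occurrence τ σ → Σ[ o₀ ∈ Occurrence (genPat τ⁰) σ ] Σ[ o₁ ∈ Occurrence φ σ ] Separated o₀ o₁
    split o = front , back , λ j → mono o _ _ (↑ˡ<↑ʳ (fromℕ r) j)
      where
      front : Occurrence (genPat τ⁰) σ
      front .idx i = idx o (i ↑ˡ L)
      front .mono p q p<q = mono o _ _ (subst₂ _<_ (sym (toℕ-↑ˡ p L)) (sym (toℕ-↑ˡ q L)) p<q)
      front .adj p q q≡1+p _ =
        adj o _ _ (trans (toℕ-↑ˡ q L) (trans q≡1+p (cong suc (sym (toℕ-↑ˡ p L)))))
                  (trans (hyph-↑ˡ p) (lookup-replicate-∷ʳ-< r p (s≤s⁻¹ (subst (_< suc r) q≡1+p (toℕ<n q)))))
      front .eqs p q = eqs o _ _ ∘ from (≈-↑ˡ p q)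
      front .lts p q p≤q p≉q = lts o _ _ (from (≤-↑ˡ p q) p≤q) (p≉q ∘ to (≈-↑ˡ p q))

      back : Occurrence φ σ
      back .idx j = idx o (suc r ↑ʳ j)
      back .mono p q p<q =
        mono o _ _ (subst₂ _<_ (sym (toℕ-↑ʳ (suc r) p)) (sym (toℕ-↑ʳ (suc r) q)) (+-monoʳ-< (suc r) p<q))
      back .adj p q q≡1+p unhyphenated = adj o _ _ (↑ʳ-adjacent (suc r) p q q≡1+p) (trans (hyph-↑ʳ p) unhyphenated)
      back .eqs p q = eqs o _ _ ∘ from (≈-↑ʳ p q)
      back .lts p q p≤q p≉q = lts o _ _ (from (≤-↑ʳ p q) p≤q) (p≉q ∘ to (≈-↑ʳ p q))

    join : (o₀ : Occurrence (genPat τ⁰) σ) (o₁ : Occurrence φ σ) → Separated o₀ o₁ → Occurrence τ σ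
    join o₀ o₁ separated = record
      { idx  = λ p → at (splitView _ _ p)
      ; mono = λ p q → mono′ (splitView _ _ p) (splitView _ _ q)
      ; adj  = λ p q → adj′ (splitView _ _ p) (splitView _ _ q)
      ; eqs  = λ p q → eqs′ (splitView _ _ p) (splitView _ _ q)
      ; lts  = λ p q → lts′ (splitView _ _ p) (splitView _ _ q)
      }
      where
      at : ∀ {p} → SplitView (suc r) L p → Fin n
      at (left i)  = idx o₀ i
      at (right j) = idx o₁ j

      mono′ : ∀ {p q} (vp : SplitView (suc r) L p) (vq : SplitView (suc r) L q) → p F.< q → at vp F.< at vq
      mono′ (left i)  (left i′)  p<q = mono o₀ i i′ (subst₂ _<_ (toℕ-↑ˡ i L) (toℕ-↑ˡ i′ L) p<q)
      mono′ (left i)  (right j)  _   = <-≤-trans (idx<end o₀ i) (separated j)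
      mono′ (right j) (left i)   q<p = contradiction (↑ˡ<↑ʳ i j) (<-asym q<p)
      mono′ (right j) (right j′) p<q =
        mono o₁ j j′ (+-cancelˡ-< (suc r) _ _ (subst₂ _<_ (toℕ-↑ʳ (suc r) j) (toℕ-↑ʳ (suc r) j′) p<q))

      adj′ : ∀ {p q} (vp : SplitView (suc r) L p) (vq : SplitView (suc r) L q) →
             toℕ q ≡ suc (toℕ p) → lookup (hyph τ) p ≡ false → toℕ (at vq) ≡ suc (toℕ (at vp))
      adj′ (left i)  (left i′)  q≡1+p _ =
        adj o₀ i i′ (trans (sym (toℕ-↑ˡ i′ L)) (trans q≡1+p (cong suc (toℕ-↑ˡ i L)))) (lookup-replicate i false)
      adj′ (left i)  (right j)  q≡1+p unhyphenated =
        contradiction (trans (sym (lookup-replicate-∷ʳ-≡ r i (↑ˡ-adjacent-↑ʳ i j q≡1+p)))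
                             (trans (sym (hyph-↑ˡ i)) unhyphenated)) λ ()
      adj′ (right j) (left i)   q≡1+p _ = contradiction (≤-reflexive (sym q≡1+p)) (<-asym (↑ˡ<↑ʳ i j))
      adj′ (right j) (right j′) q≡1+p unhyphenated =
        adj o₁ j j′ (↑ʳ-adjacent⁻¹ (suc r) j j′ q≡1+p) (trans (sym (hyph-↑ʳ j)) unhyphenated)

      eqs′ : ∀ {p q} (vp : SplitView (suc r) L p) (vq : SplitView (suc r) L q) →
             lookup (letters τ) p T.≈ lookup (letters τ) q → lookup σ (at vp) ≡ lookup σ (at vq)
      eqs′ (left i)  (left i′)  = eqs o₀ i i′ ∘ to (≈-↑ˡ i i′)
      eqs′ (left i)  (right j)  p≈q = contradiction (subst₂ T._≈_ (letters-↑ˡ i) (letters-↑ʳ j) p≈q) λ ()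
      eqs′ (right j) (left i)   p≈q = contradiction (subst₂ T._≈_ (letters-↑ʳ j) (letters-↑ˡ i) p≈q) λ ()
      eqs′ (right j) (right j′) = eqs o₁ j j′ ∘ to (≈-↑ʳ j j′)

      lts′ : ∀ {p q} (vp : SplitView (suc r) L p) (vq : SplitView (suc r) L q) →
             lookup (letters τ) p T.≤ lookup (letters τ) q → ¬ (lookup (letters τ) p T.≈ lookup (letters τ) q) →
             lookup σ (at vp) F.< lookup σ (at vq)
      lts′ (left i)  (left i′)  p≤q p≉q = lts o₀ i i′ (to (≤-↑ˡ i i′) p≤q) (p≉q ∘ from (≈-↑ˡ i i′))
      lts′ (left i)  (right j)  p≤q _   = contradiction (subst₂ T._≤_ (letters-↑ˡ i) (letters-↑ʳ j) p≤q) λ ()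
      lts′ (right j) (left i)   p≤q _   = contradiction (subst₂ T._≤_ (letters-↑ʳ j) (letters-↑ˡ i) p≤q) λ ()
      lts′ (right j) (right j′) p≤q p≉q = lts o₁ j j′ (to (≤-↑ʳ j j′) p≤q) (p≉q ∘ from (≈-↑ʳ j j′))

  avoids-τ⁰⇒avoids-τ : ∀ {k n} {σ : Word k n} → Avoids (genPat τ⁰) σ → Avoids τ σ
  avoids-τ⁰⇒avoids-τ avoids = avoids ∘ proj₁ ∘ split

  module _ {k a b : ℕ} {α : Word k a} {β : Word k b} where

    avoids⇔suffix-avoids : ShortestPrefixContaining τ⁰ (α ++ β) a → Avoids τ (α ++ β) ⇔ Avoids φ β
    avoids⇔suffix-avoids (o₀ , end≡a , a≤end) = mk⇔ suffix-avoids whole-avoids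
      where
      suffix-avoids : Avoids τ (α ++ β) → Avoids φ β
      suffix-avoids avoids-τ o₁ = avoids-τ (join o₀ (push (suffix α β) o₁)
        λ j → subst₂ _≤_ (sym end≡a) (sym (toℕ-↑ʳ a (idx o₁ j))) (m≤m+n a _))

      whole-avoids : Avoids φ β → Avoids τ (α ++ β)
      whole-avoids avoids-φ o with split o
      ... | o₀′ , o₁ , separated = avoids-φ (restrictʳ α β o₁ λ j → ≤-trans (a≤end o₀′) (separated j))

  Block : {k n : ℕ} → ℕ → Word k n → Set
  Block a σ = ShortestPrefixContaining τ⁰ σ a × Avoids τ σ

  module _ {k a b : ℕ} where

    quasiAvoids×avoids⇔Block : (w : Word k (a + b)) →
                                 (∃₂ λ α β → QuasiAvoids τ⁰ α × Avoids φ β × w ≡ α ++ β) ⇔ Block a w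
    quasiAvoids×avoids⇔Block w = mk⇔ glue cut
      where
      glue : (∃₂ λ α β → QuasiAvoids τ⁰ α × Avoids φ β × w ≡ α ++ β) → Block a w
      glue (α , β , quasi , avoids-φ , refl) =
        shortest , from (avoids⇔suffix-avoids shortest) avoids-φ
        where shortest = to (quasiAvoids⇔shortestPrefix {β = β}) quasi

      cut : Block a w → ∃₂ λ α β → QuasiAvoids τ⁰ α × Avoids φ β × w ≡ α ++ β
      cut (shortest , avoids-τ) with splitAt a w
      ... | α , β , refl =
        α , β , from quasiAvoids⇔shortestPrefix shortest , to (avoids⇔suffix-avoids shortest) avoids-τ , refl

    Block-count : {c d : ℕ} → IsCount {k} {a} (QuasiAvoids τ⁰) c → IsCount {k} {b} (Avoids φ) d →
                  IsCount {k} {a + b} (Block a) (c * d)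
    Block-count quasi-count avoids-count = IsCount-resp quasiAvoids×avoids⇔Block (IsCount-++ quasi-count avoids-count)

  avoids-τ⇒¬¬decomposition : ∀ {k n} (σ : Word k n) → Avoids τ σ →
                              ¬ ¬ (Avoids (genPat τ⁰) σ ⊎ ∃[ i ] i < suc n × Block (n ∸ i) σ)
  avoids-τ⇒¬¬decomposition {n = n} σ avoids-τ none =
    none (inj₁ λ o → shortestPrefix-exists o λ (a , shortest) →
      none (inj₂ (n ∸ a , s≤s (m∸n≤m n a) ,
                  subst (λ a → Block a σ) (sym (m∸[m∸n]≡n (a≤n shortest))) (shortest , avoids-τ))))
    where
    a≤n : ∀ {a} → ShortestPrefixContaining τ⁰ σ a → a ≤ n
    a≤n (o , end≡a , _) = subst (_≤ n) end≡a (toℕ<n (idx o (fromℕ r)))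

mainTheorem10 : {m r : ℕ} (τ⁰ : Vec (Fin m) (suc r)) → UsesAll τ⁰ →
    (P : Poset 0ℓ 0ℓ 0ℓ) (φ : POGP P) →
    (k : ℕ) → 1 ≤ k →
    (aτ aτ⁰ aφ qτ⁰ : ℕ → ℕ) →
    (∀ n → IsCount {k} {n} (Avoids (concatPat τ⁰ φ)) (aτ n)) →
    (∀ n → IsCount {k} {n} (Avoids (genPat τ⁰)) (aτ⁰ n)) →
    (∀ n → IsCount {k} {n} (Avoids φ) (aφ n)) →
    (∀ n → IsCount {k} {n} (QuasiAvoids τ⁰) (qτ⁰ n)) →
    ∀ n → aτ n ≡ aτ⁰ n + conv aφ qτ⁰ n
mainTheorem10 τ⁰ _ P φ k _ aτ aτ⁰ aφ qτ⁰ τ-count τ⁰-count φ-count quasi-count n =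
  IsCount-unique (τ-count n) (IsCount-⊎ (τ⁰-count n) blocks-count λ avoids (_ , _ , (o , _) , _) → avoids o)
    avoids-τ⇒¬¬decomposition (λ _ → [ avoids-τ⁰⇒avoids-τ , proj₂ ∘ proj₂ ∘ proj₂ ]′)
  where
  open Concatenation τ⁰ φ

  block-count : ∀ i → i < suc n → IsCount {k} {n} (Block (n ∸ i)) (aφ i * qτ⁰ (n ∸ i))
  block-count i i<1+n = subst₂ (λ l c → IsCount {k} {l} (Block (n ∸ i)) c)
    (m∸n+n≡m (s≤s⁻¹ i<1+n)) (*-comm (qτ⁰ (n ∸ i)) (aφ i)) (Block-count (quasi-count (n ∸ i)) (φ-count i))

  blocks-count : IsCount (λ w → ∃[ i ] i < suc n × Block (n ∸ i) w) (conv aφ qτ⁰ n)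
  blocks-count = IsCount-⋃ (suc n) block-count λ i<1+n i′<1+n (shortest , _) (shortest′ , _) →
    ∸-cancelˡ-≡ (s≤s⁻¹ i<1+n) (s≤s⁻¹ i′<1+n) (shortestPrefix-unique shortest shortest′)
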